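{- For every positive integer $n$ and every $n\times n$ square sign matrix $A$, $\mathrm{inv}(A)\le\binom{n}{2}$. Moreover, the only $n\times n$ square sign matrix $A$ with $\mathrm{inv}(A)=\binom{n}{2}$ is the antidiagonal permutation matrix (the matrix with $a_{i,n+1-i}=1$ for all $i$ and all other entries $0$).
   Context: An $n\times n$ square sign matrix is an $n\times n$ matrix $A=(a_{ij})$ with entries in $\{0,1,-1\}$ such that all row sums and all column sums equal $1$, $0\le \sum_{i'=1}^{i}a_{i'j}\le 1$ for all $1\le i,j\le n$, and $\sum_{j'=1}^{j}a_{ij'}\ge 0$ for all $1\le i,j\le n$. The inversion number of $A$ is $\mathrm{inv}(A)=\sum_{1\le k<i\le n}\sum_{1\le j<l\le n}a_{ij}a_{kl}$. -}

module Defs where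

open import Data.Nat using (ℕ; zero; suc)
open import Data.Fin using (Fin; toℕ; _<_; _≤_; opposite)
open import Data.Fin.Properties using (_<?_; _≤?_)
open import Data.Integer using (ℤ; 0ℤ; 1ℤ; -1ℤ; _+_; _*_)
import Data.Integer as ℤ
open import Data.Product using (_×_)
open import Data.Sum using (_⊎_)
open import Relation.Binary.PropositionalEquality using (_≡_)
open import Relation.Nullary.Decidable using (Dec; yes; no)

-- n × n integer matrices, indexed by Fin n (0-based: index i stands for row i+1).
Matrix : ℕ → Set
Matrix n = Fin n → Fin n → ℤ

sumFin : ∀ {n} → (Fin n → ℤ) → ℤ
sumFin {zero}  f = 0ℤ
sumFin {suc n} f = f Fin.zero + sumFin (λ i → f (Fin.suc i))
  where import Data.Fin as Fin

sumWhere : ∀ {n} {P : Fin n → Set} → ((i : Fin n) → Dec (P i)) → (Fin n → ℤ) → ℤ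
sumWhere P? f = sumFin (λ i → cond (P? i) (f i))
  where
  cond : ∀ {A : Set} → Dec A → ℤ → ℤ
  cond (yes _) x = x
  cond (no _)  _ = 0ℤ

colPartial : ∀ {n} → Matrix n → Fin n → Fin n → ℤ
colPartial A i j = sumWhere (λ i' → i' ≤? i) (λ i' → A i' j)

rowPartial : ∀ {n} → Matrix n → Fin n → Fin n → ℤ
rowPartial A i j = sumWhere (λ j' → j' ≤? j) (λ j' → A i j')

record IsSquareSignMatrix {n : ℕ} (A : Matrix n) : Set where
  field
    entries   : ∀ i j → (A i j ≡ 0ℤ) ⊎ ((A i j ≡ 1ℤ) ⊎ (A i j ≡ -1ℤ))
    rowSum    : ∀ i → sumFin (λ j → A i j) ≡ 1ℤ
    colSum    : ∀ j → sumFin (λ i → A i j) ≡ 1ℤ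
    colPartialBounds : ∀ i j → (0ℤ ℤ.≤ colPartial A i j) × (colPartial A i j ℤ.≤ 1ℤ)
    rowPartialNonneg : ∀ i j → 0ℤ ℤ.≤ rowPartial A i j

inv : ∀ {n} → Matrix n → ℤ
inv A = sumFin λ i → sumWhere (λ k → k <? i) λ k →
        sumFin λ j → sumWhere (λ l → j <? l) λ l → A i j * A k l

-- antidiagonal permutation matrix: a_{i,n+1-i} = 1 (0-based: column = opposite i)
antidiagonal : ∀ {n} → Matrix n
antidiagonal i j with toℕ j Data.Nat.≟ toℕ (opposite i)
  where import Data.Nat
... | yes _ = 1ℤ
... | no _  = 0ℤ

-- Write R i j = Σ_{l<j} a i l and C i j = Σ_{k<i} a k j for the exclusive row and column prefix
-- sums, so that inv A = Σ_{i,j} R i j · C i j. When every row and column sums to 1, expanding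
-- 2 (R' (1 − C') + R C) with R' = R + a i j and C' = C + a i j and telescoping along rows and
-- columns gives
--     inv A + Σ_{i,j} R i (j+1) · (1 − C (i+1) j) = n choose 2.
-- For a square sign matrix R i (j+1) ≥ 0 and C (i+1) j ≤ 1, so every defect in this sum is
-- nonnegative, which is the bound. At equality all defects vanish. In the last column this forces
-- C (i+1) (n−1) = 1 for every i, so that column is (1, 0, …, 0); the first row, whose entries are
-- nonnegative, then vanishes elsewhere, and deleting the first row and the last column leaves a
-- smaller matrix with the same properties.
module Submission where

open import Defs
open import Data.Nat using (ℕ) renaming (_≤_ to _≤ℕ_)
open import Data.Nat.Combinatorics using (_C_)
open import Data.Integer using (ℤ; +_; _≤_)
open import Data.Product using (_×_)
open import Relation.Binary.PropositionalEquality using (_≡_)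

open import Data.Empty using (⊥-elim)
open import Data.Fin using (Fin; zero; suc; toℕ; fromℕ<; opposite)
open import Data.Fin.Properties using (toℕ<n; toℕ-fromℕ<; fromℕ<-toℕ; opposite-prop)
open import Data.Integer using (0ℤ; 1ℤ; -1ℤ; _+_; _-_; _*_; +≤+)
import Data.Integer.Properties as ℤₚ
open import Algebra.Properties.AbelianGroup ℤₚ.+-0-abelianGroup
  using (identityˡ-unique; identityʳ-unique)
open import Data.Integer.Tactic.RingSolver using (solve-∀)
open import Data.Nat as ℕ using (zero; suc; z≤n; s≤s; s≤s⁻¹; z<s; _<_)
open import Data.Nat.Combinatorics using (nC1≡n; nCk+nC[k+1]≡[n+1]C[k+1])
import Data.Nat.Properties as ℕₚ
open import Data.Product using (_,_; proj₁; proj₂)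
open import Data.Sum using (_⊎_; inj₁; inj₂)
open import Relation.Binary.PropositionalEquality
  using (refl; sym; trans; cong; cong₂; subst; subst₂; module ≡-Reasoning)
open import Relation.Nullary using (Dec; yes; no; ¬_)

open ≡-Reasoning

cond : ∀ {P : Set} → Dec P → ℤ → ℤ
cond (yes _) x = x
cond (no _)  _ = 0ℤ

cond-yes : ∀ {P : Set} (d : Dec P) {x : ℤ} → P → cond d x ≡ x
cond-yes (yes _) _ = refl
cond-yes (no ¬p) p = ⊥-elim (¬p p)

cond-no : ∀ {P : Set} (d : Dec P) {x : ℤ} → ¬ P → cond d x ≡ 0ℤ
cond-no (yes p) ¬p = ⊥-elim (¬p p)
cond-no (no _)  _  = refl

cond-cong : ∀ {P Q : Set} (d : Dec P) (e : Dec Q) → (P → Q) → (Q → P) → ∀ x → cond d x ≡ cond e x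
cond-cong d (yes q) _   Q⇒P _ = cond-yes d (Q⇒P q)
cond-cong d (no ¬q) P⇒Q _   _ = cond-no d (λ p → ¬q (P⇒Q p))

cond-1-isSignEntry : ∀ {P : Set} (d : Dec P) →
  (cond d 1ℤ ≡ 0ℤ) ⊎ ((cond d 1ℤ ≡ 1ℤ) ⊎ (cond d 1ℤ ≡ -1ℤ))
cond-1-isSignEntry (yes _) = inj₂ (inj₁ refl)
cond-1-isSignEntry (no _)  = inj₁ refl

cond-1-bounds : ∀ {P : Set} (d : Dec P) → (0ℤ ≤ cond d 1ℤ) × (cond d 1ℤ ≤ 1ℤ)
cond-1-bounds (yes _) = +≤+ z≤n , +≤+ (s≤s z≤n)
cond-1-bounds (no _)  = +≤+ z≤n , +≤+ z≤n

cond-1*[1-cond-1]≡0 : ∀ {P : Set} (d : Dec P) → cond d 1ℤ * (1ℤ - cond d 1ℤ) ≡ 0ℤ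
cond-1*[1-cond-1]≡0 (yes _) = refl
cond-1*[1-cond-1]≡0 (no _)  = refl

*-nonneg : ∀ {x y} → 0ℤ ≤ x → 0ℤ ≤ y → 0ℤ ≤ x * y
*-nonneg {+ a} {+ b} _ _ = subst (0ℤ ≤_) (ℤₚ.pos-* a b) (+≤+ z≤n)

+-nonneg-≡0 : ∀ {x y} → 0ℤ ≤ x → 0ℤ ≤ y → x + y ≡ 0ℤ → (x ≡ 0ℤ) × (y ≡ 0ℤ)
+-nonneg-≡0 {+ a} {+ b} _ _ eq =
  cong +_ (ℕₚ.m+n≡0⇒m≡0 a (ℤₚ.+-injective eq)) , cong +_ (ℕₚ.m+n≡0⇒n≡0 a (ℤₚ.+-injective eq))

nonneg+≡⇒≤ : ∀ {x y c} → 0ℤ ≤ x → x + y ≡ c → y ≤ c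
nonneg+≡⇒≤ {+ t} {y} _ eq = subst (y ≤_) eq (ℤₚ.i≤j+i y (+ t))

∀<-init : ∀ {m} {P : ℕ → Set} → (∀ k → k < suc m → P k) → ∀ k → k < m → P k
∀<-init h k k<m = h k (ℕₚ.m<n⇒m<1+n k<m)

∑ : ℕ → (ℕ → ℤ) → ℤ
∑ zero    f = 0ℤ
∑ (suc m) f = ∑ m f + f m

∑-cong : ∀ m {f g : ℕ → ℤ} → (∀ k → k < m → f k ≡ g k) → ∑ m f ≡ ∑ m g
∑-cong zero    _   = refl
∑-cong (suc m) f≡g = cong₂ _+_ (∑-cong m (∀<-init f≡g)) (f≡g m ℕₚ.≤-refl)

∑-zeros : ∀ m → ∑ m (λ _ → 0ℤ) ≡ 0ℤ
∑-zeros zero    = refl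
∑-zeros (suc m) = trans (ℤₚ.+-identityʳ _) (∑-zeros m)

∑-distrib-+ : ∀ m (f g : ℕ → ℤ) → ∑ m (λ k → f k + g k) ≡ ∑ m f + ∑ m g
∑-distrib-+ zero    f g = refl
∑-distrib-+ (suc m) f g =
  trans (cong (_+ (f m + g m)) (∑-distrib-+ m f g)) (interchange (∑ m f) (∑ m g) (f m) (g m))
  where
  interchange : ∀ a b c d → (a + b) + (c + d) ≡ (a + c) + (b + d)
  interchange = solve-∀

∑-distrib-sub : ∀ m (f g : ℕ → ℤ) → ∑ m (λ k → f k - g k) ≡ ∑ m f - ∑ m g
∑-distrib-sub zero    f g = refl
∑-distrib-sub (suc m) f g =
  trans (cong (_+ (f m - g m)) (∑-distrib-sub m f g)) (interchange (∑ m f) (∑ m g) (f m) (g m))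
  where
  interchange : ∀ a b c d → (a - b) + (c - d) ≡ (a + c) - (b + d)
  interchange = solve-∀

∑-distribˡ-* : ∀ m c (f : ℕ → ℤ) → ∑ m (λ k → c * f k) ≡ c * ∑ m f
∑-distribˡ-* zero    c f = sym (ℤₚ.*-zeroʳ c)
∑-distribˡ-* (suc m) c f =
  trans (cong (_+ c * f m) (∑-distribˡ-* m c f)) (sym (ℤₚ.*-distribˡ-+ c (∑ m f) (f m)))

∑-distribʳ-* : ∀ m c (f : ℕ → ℤ) → ∑ m (λ k → f k * c) ≡ ∑ m f * c
∑-distribʳ-* zero    c f = refl
∑-distribʳ-* (suc m) c f =
  trans (cong (_+ f m * c) (∑-distribʳ-* m c f)) (sym (ℤₚ.*-distribʳ-+ c (∑ m f) (f m)))

∑-comm : ∀ m p (f : ℕ → ℕ → ℤ) → ∑ m (λ i → ∑ p (f i)) ≡ ∑ p (λ j → ∑ m (λ i → f i j))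
∑-comm zero    p f = sym (∑-zeros p)
∑-comm (suc m) p f =
  trans (cong (_+ ∑ p (f m)) (∑-comm m p f)) (sym (∑-distrib-+ p (λ j → ∑ m (λ i → f i j)) (f m)))

∑-shift : ∀ m (f : ℕ → ℤ) → ∑ (suc m) f ≡ f 0 + ∑ m (λ k → f (suc k))
∑-shift zero    f = trans (ℤₚ.+-identityˡ (f 0)) (sym (ℤₚ.+-identityʳ (f 0)))
∑-shift (suc m) f = trans (cong (_+ f (suc m)) (∑-shift m f)) (ℤₚ.+-assoc (f 0) _ _)

∑-ones : ∀ m → ∑ m (λ _ → 1ℤ) ≡ + m
∑-ones zero    = refl
∑-ones (suc m) = trans (cong (_+ 1ℤ) (∑-ones m)) (cong +_ (ℕₚ.+-comm m 1))

∑-identity : ∀ m → ∑ m (λ j → + j) ≡ + (m C 2)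
∑-identity zero    = refl
∑-identity (suc m) = trans (cong (_+ + m) (∑-identity m)) (cong +_ (begin
  m C 2 ℕ.+ m      ≡⟨ ℕₚ.+-comm (m C 2) m ⟩
  m ℕ.+ m C 2      ≡⟨ cong (ℕ._+ m C 2) (nC1≡n m) ⟨
  m C 1 ℕ.+ m C 2  ≡⟨ nCk+nC[k+1]≡[n+1]C[k+1] m 1 ⟩
  suc m C 2        ∎))

∑-suc : ∀ m → ∑ m (λ j → + suc j) ≡ + m + + (m C 2)
∑-suc m = trans (∑-distrib-+ m (λ _ → 1ℤ) (λ j → + j)) (cong₂ _+_ (∑-ones m) (∑-identity m))

∑-square : ∀ m (g : ℕ → ℤ) → ∑ m (λ j → g j * (+ 2 * ∑ j g + g j)) ≡ ∑ m g * ∑ m g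
∑-square zero    g = refl
∑-square (suc m) g =
  trans (cong (_+ g m * (+ 2 * ∑ m g + g m)) (∑-square m g)) (expand (∑ m g) (g m))
  where
  expand : ∀ s x → s * s + x * (+ 2 * s + x) ≡ (s + x) * (s + x)
  expand = solve-∀

∑-nonneg : ∀ m (f : ℕ → ℤ) → (∀ k → k < m → 0ℤ ≤ f k) → 0ℤ ≤ ∑ m f
∑-nonneg zero    f _   = +≤+ z≤n
∑-nonneg (suc m) f f≥0 = ℤₚ.+-mono-≤ (∑-nonneg m f (∀<-init f≥0)) (f≥0 m ℕₚ.≤-refl)

∑-nonneg-≡0 : ∀ m (f : ℕ → ℤ) → (∀ k → k < m → 0ℤ ≤ f k) → ∑ m f ≡ 0ℤ → ∀ k → k < m → f k ≡ 0ℤ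
∑-nonneg-≡0 (suc m) f f≥0 ∑≡0 k k<1+m
  with +-nonneg-≡0 (∑-nonneg m f (∀<-init f≥0)) (f≥0 m ℕₚ.≤-refl) ∑≡0
     | ℕₚ.m≤n⇒m<n∨m≡n (s≤s⁻¹ k<1+m)
... | init≡0 , _       | inj₁ k<m = ∑-nonneg-≡0 m f (∀<-init f≥0) init≡0 k k<m
... | _      , last≡0 | inj₂ refl = last≡0

∑-cond-prefix : ∀ {P : ℕ → Set} (P? : ∀ k → Dec (P k)) {p} m →
  (∀ k → P k → k < p) → (∀ k → k < p → P k) → p ≤ℕ m →
  (f : ℕ → ℤ) → ∑ m (λ k → cond (P? k) (f k)) ≡ ∑ p f
∑-cond-prefix P? zero    _   _   z≤n     f = refl
∑-cond-prefix P? (suc m) P⇒< <⇒P p≤1+m f with ℕₚ.m≤n⇒m<n∨m≡n p≤1+m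
... | inj₂ refl  = ∑-cong (suc m) (λ k k<p → cond-yes (P? k) (<⇒P k k<p))
... | inj₁ p<1+m = trans
  (cong₂ _+_ (∑-cond-prefix P? m P⇒< <⇒P (s≤s⁻¹ p<1+m) f)
             (cond-no (P? m) (λ Pm → ℕₚ.<⇒≱ (P⇒< m Pm) (s≤s⁻¹ p<1+m))))
  (ℤₚ.+-identityʳ _)

∑∑ : ℕ → (ℕ → ℕ → ℤ) → ℤ
∑∑ n f = ∑ n (λ i → ∑ n (f i))

∑∑-cong : ∀ n {f g : ℕ → ℕ → ℤ} → (∀ i j → i < n → j < n → f i j ≡ g i j) → ∑∑ n f ≡ ∑∑ n g
∑∑-cong n f≡g = ∑-cong n (λ i i<n → ∑-cong n (λ j j<n → f≡g i j i<n j<n))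

∑∑-distrib-+ : ∀ n (f g : ℕ → ℕ → ℤ) → ∑∑ n (λ i j → f i j + g i j) ≡ ∑∑ n f + ∑∑ n g
∑∑-distrib-+ n f g = trans (∑-cong n (λ i _ → ∑-distrib-+ n (f i) (g i))) (∑-distrib-+ n _ _)

∑∑-distrib-sub : ∀ n (f g : ℕ → ℕ → ℤ) → ∑∑ n (λ i j → f i j - g i j) ≡ ∑∑ n f - ∑∑ n g
∑∑-distrib-sub n f g = trans (∑-cong n (λ i _ → ∑-distrib-sub n (f i) (g i))) (∑-distrib-sub n _ _)

∑∑-distribˡ-* : ∀ n c (f : ℕ → ℕ → ℤ) → ∑∑ n (λ i j → c * f i j) ≡ c * ∑∑ n f
∑∑-distribˡ-* n c f = trans (∑-cong n (λ i _ → ∑-distribˡ-* n c (f i))) (∑-distribˡ-* n c _)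

∑∑-nonneg : ∀ n (f : ℕ → ℕ → ℤ) → (∀ i j → i < n → j < n → 0ℤ ≤ f i j) → 0ℤ ≤ ∑∑ n f
∑∑-nonneg n f f≥0 = ∑-nonneg n _ (λ i i<n → ∑-nonneg n (f i) (λ j j<n → f≥0 i j i<n j<n))

∑∑-nonneg-≡0 : ∀ n (f : ℕ → ℕ → ℤ) → (∀ i j → i < n → j < n → 0ℤ ≤ f i j) → ∑∑ n f ≡ 0ℤ →
  ∀ i j → i < n → j < n → f i j ≡ 0ℤ
∑∑-nonneg-≡0 n f f≥0 ∑∑≡0 i j i<n = ∑-nonneg-≡0 n (f i) (λ j j<n → f≥0 i j i<n j<n) row≡0 j
  where
  row≡0 : ∑ n (f i) ≡ 0ℤ
  row≡0 = ∑-nonneg-≡0 n _ (λ i i<n → ∑-nonneg n (f i) (λ j j<n → f≥0 i j i<n j<n)) ∑∑≡0 i i<n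

sumFin≡∑ : ∀ {n} (F : Fin n → ℤ) (g : ℕ → ℤ) → (∀ i → F i ≡ g (toℕ i)) → sumFin F ≡ ∑ n g
sumFin≡∑ {zero}  F g _   = refl
sumFin≡∑ {suc n} F g F≡g = trans
  (cong₂ _+_ (F≡g zero) (sumFin≡∑ (λ i → F (suc i)) (λ k → g (suc k)) (λ i → F≡g (suc i))))
  (sym (∑-shift n g))

sumWhere≡∑ : ∀ {n} {Q : ℕ → Set} (Q? : ∀ k → Dec (Q k)) (F : Fin n → ℤ) (g : ℕ → ℤ) →
  (∀ i → F i ≡ g (toℕ i)) → sumWhere (λ i → Q? (toℕ i)) F ≡ ∑ n (λ k → cond (Q? k) (g k))
sumWhere≡∑ {zero}  Q? F g _ = refl
sumWhere≡∑ {suc n} Q? F g F≡g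
  with Q? 0 | sumWhere≡∑ (λ k → Q? (suc k)) (λ i → F (suc i)) (λ k → g (suc k)) (λ i → F≡g (suc i))
... | yes q | rest =
  trans (cong₂ _+_ (trans (F≡g zero) (sym (cond-yes (Q? 0) q))) rest) (sym (∑-shift n _))
... | no ¬q | rest =
  trans (cong₂ _+_ (sym (cond-no (Q? 0) ¬q)) rest) (sym (∑-shift n _))

extend : ∀ {n} → Matrix n → ℕ → ℕ → ℤ
extend {n} A x y with x ℕ.<? n | y ℕ.<? n
... | yes x<n | yes y<n = A (fromℕ< x<n) (fromℕ< y<n)
... | _       | _       = 0ℤ

extend-toℕ : ∀ {n} (A : Matrix n) i j → A i j ≡ extend A (toℕ i) (toℕ j)
extend-toℕ {n} A i j with toℕ i ℕ.<? n | toℕ j ℕ.<? n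
... | yes i<n | yes j<n = sym (cong₂ A (fromℕ<-toℕ i i<n) (fromℕ<-toℕ j j<n))
... | no i≮n  | _       = ⊥-elim (i≮n (toℕ<n i))
... | yes _   | no j≮n  = ⊥-elim (j≮n (toℕ<n j))

∀Fin⇒∀< : ∀ {n} {P : ℕ → Set} → (∀ (i : Fin n) → P (toℕ i)) → ∀ i → i < n → P i
∀Fin⇒∀< {P = P} h i i<n = subst P (toℕ-fromℕ< i<n) (h (fromℕ< i<n))

∀Fin²⇒∀<² : ∀ {n} {P : ℕ → ℕ → Set} → (∀ (i j : Fin n) → P (toℕ i) (toℕ j)) →
  ∀ i j → i < n → j < n → P i j
∀Fin²⇒∀<² {P = P} h i j i<n j<n =
  subst₂ P (toℕ-fromℕ< i<n) (toℕ-fromℕ< j<n) (h (fromℕ< i<n) (fromℕ< j<n))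

-- Prefix sums are exclusive: the paper's partial sums Σ_{j' ≤ j} a i j' and Σ_{i' ≤ i} a i' j
-- are rowPrefix a i (suc j) and colPrefix a (suc i) j.
module _ (a : ℕ → ℕ → ℤ) where

  rowPrefix : ℕ → ℕ → ℤ
  rowPrefix i j = ∑ j (a i)

  colPrefix : ℕ → ℕ → ℤ
  colPrefix i j = ∑ i (λ k → a k j)

  defect : ℕ → ℕ → ℤ
  defect i j = rowPrefix i (suc j) * (1ℤ - colPrefix (suc i) j)

inversions : ℕ → (ℕ → ℕ → ℤ) → ℤ
inversions n a = ∑∑ n (λ i j → rowPrefix a i j * colPrefix a i j)

module _ {n} (A : Matrix n) where

  rowSum≡rowPrefix : ∀ i → sumFin (λ j → A i j) ≡ rowPrefix (extend A) (toℕ i) n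
  rowSum≡rowPrefix i = sumFin≡∑ _ _ (extend-toℕ A i)

  colSum≡colPrefix : ∀ j → sumFin (λ i → A i j) ≡ colPrefix (extend A) n (toℕ j)
  colSum≡colPrefix j = sumFin≡∑ _ _ (λ i → extend-toℕ A i j)

  rowPartial≡rowPrefix : ∀ i j → rowPartial A i j ≡ rowPrefix (extend A) (toℕ i) (suc (toℕ j))
  rowPartial≡rowPrefix i j = trans
    (sumWhere≡∑ (ℕ._≤? toℕ j) _ _ (extend-toℕ A i))
    (∑-cond-prefix _ n (λ _ → s≤s) (λ _ → s≤s⁻¹) (toℕ<n j) _)

  colPartial≡colPrefix : ∀ i j → colPartial A i j ≡ colPrefix (extend A) (suc (toℕ i)) (toℕ j)
  colPartial≡colPrefix i j = trans
    (sumWhere≡∑ (ℕ._≤? toℕ i) _ _ (λ k → extend-toℕ A k j))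
    (∑-cond-prefix _ n (λ _ → s≤s) (λ _ → s≤s⁻¹) (toℕ<n i) _)

  inv≡inversions : inv A ≡ inversions n (extend A)
  inv≡inversions = trans inv≡∑ (∑-cong n row≡)
    where
    a : ℕ → ℕ → ℤ
    a = extend A

    crossing : ℕ → ℕ → ℤ
    crossing i k = ∑ n λ j → ∑ n λ l → cond (j ℕ.<? l) (a i j * a k l)

    inv≡∑ : inv A ≡ ∑ n λ i → ∑ n λ k → cond (k ℕ.<? i) (crossing i k)
    inv≡∑ =
      sumFin≡∑ _ _ λ i → sumWhere≡∑ (ℕ._<? toℕ i) _ _ λ k →
      sumFin≡∑ _ _ λ j → sumWhere≡∑ (toℕ j ℕ.<?_) _ _ λ l →
      cong₂ _*_ (extend-toℕ A i j) (extend-toℕ A k l)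

    row≡ : ∀ i → i < n →
      ∑ n (λ k → cond (k ℕ.<? i) (crossing i k)) ≡ ∑ n (λ l → rowPrefix a i l * colPrefix a i l)
    row≡ i i<n = begin
      ∑ n (λ k → cond (k ℕ.<? i) (crossing i k))
        ≡⟨ ∑-cond-prefix _ n (λ _ k<i → k<i) (λ _ k<i → k<i) (ℕₚ.<⇒≤ i<n) _ ⟩
      ∑ i (λ k → ∑ n λ j → ∑ n λ l → cond (j ℕ.<? l) (a i j * a k l))
        ≡⟨ ∑-cong i (λ k _ → ∑-comm n n _) ⟩
      ∑ i (λ k → ∑ n λ l → ∑ n λ j → cond (j ℕ.<? l) (a i j * a k l))
        ≡⟨ ∑-cong i (λ k _ → ∑-cong n λ l l<n →
             trans (∑-cond-prefix _ n (λ _ j<l → j<l) (λ _ j<l → j<l) (ℕₚ.<⇒≤ l<n) _)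
                   (∑-distribʳ-* l (a k l) (a i))) ⟩
      ∑ i (λ k → ∑ n λ l → rowPrefix a i l * a k l)
        ≡⟨ ∑-comm i n _ ⟩
      ∑ n (λ l → ∑ i λ k → rowPrefix a i l * a k l)
        ≡⟨ ∑-cong n (λ l _ → ∑-distribˡ-* i (rowPrefix a i l) (λ k → a k l)) ⟩
      ∑ n (λ l → rowPrefix a i l * colPrefix a i l) ∎

module _ (n : ℕ) (a : ℕ → ℕ → ℤ)
         (rowSum≡1 : ∀ i → i < n → rowPrefix a i n ≡ 1ℤ)
         (colSum≡1 : ∀ j → j < n → colPrefix a n j ≡ 1ℤ) where

  private
    rowSquareStep colSquareStep : ℕ → ℕ → ℤ
    rowSquareStep i j = a i j * (+ 2 * rowPrefix a i j + a i j)
    colSquareStep i j = a i j * (+ 2 * colPrefix a i j + a i j)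

    rowSquares : ∑∑ n rowSquareStep ≡ + n
    rowSquares = trans
      (∑-cong n (λ i i<n → trans (∑-square n (a i)) (cong₂ _*_ (rowSum≡1 i i<n) (rowSum≡1 i i<n))))
      (∑-ones n)

    colSquares : ∑∑ n colSquareStep ≡ + n
    colSquares = trans (∑-comm n n _) (trans
      (∑-cong n (λ j j<n →
        trans (∑-square n (λ i → a i j)) (cong₂ _*_ (colSum≡1 j j<n) (colSum≡1 j j<n))))
      (∑-ones n))

    ∑∑rowPrefix : ∑∑ n (λ i j → rowPrefix a i (suc j)) ≡ + n + + (n C 2)
    ∑∑rowPrefix = begin
      ∑ n (λ i → ∑ n λ j → ∑ (suc j) (a i))     ≡⟨ ∑-comm n n _ ⟩
      ∑ n (λ j → ∑ n λ i → ∑ (suc j) (a i))     ≡⟨ ∑-cong n (λ j _ → ∑-comm n (suc j) a) ⟩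
      ∑ n (λ j → ∑ (suc j) λ l → colPrefix a n l)
        ≡⟨ ∑-cong n (λ j j<n → trans (∑-cong (suc j) (λ l l<1+j → colSum≡1 l (ℕₚ.<-≤-trans l<1+j j<n)))
                                     (∑-ones (suc j))) ⟩
      ∑ n (λ j → + suc j)                        ≡⟨ ∑-suc n ⟩
      + n + + (n C 2)                            ∎

    -- x (2 R + x) = (R + x)² - R², so the last two terms telescope along rows and along columns.
    twice-defect+crossing : ∀ R C x →
      + 2 * ((R + x) * (1ℤ - (C + x)) + R * C) ≡ + 2 * (R + x) - x * (+ 2 * R + x) - x * (+ 2 * C + x)
    twice-defect+crossing = solve-∀

  ∑∑defect+inversions≡C2 : ∑∑ n (defect a) + inversions n a ≡ + (n C 2)
  ∑∑defect+inversions≡C2 = ℤₚ.*-cancelˡ-≡ (+ 2) _ _ (begin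
    + 2 * (∑∑ n (defect a) + inversions n a)
      ≡⟨ cong (+ 2 *_) (∑∑-distrib-+ n (defect a) _) ⟨
    + 2 * ∑∑ n (λ i j → defect a i j + rowPrefix a i j * colPrefix a i j)
      ≡⟨ ∑∑-distribˡ-* n (+ 2) _ ⟨
    ∑∑ n (λ i j → + 2 * (defect a i j + rowPrefix a i j * colPrefix a i j))
      ≡⟨ ∑∑-cong n (λ i j _ _ → twice-defect+crossing (rowPrefix a i j) (colPrefix a i j) (a i j)) ⟩
    ∑∑ n (λ i j → + 2 * rowPrefix a i (suc j) - rowSquareStep i j - colSquareStep i j)
      ≡⟨ trans (∑∑-distrib-sub n _ _) (cong (_- ∑∑ n colSquareStep) (∑∑-distrib-sub n _ _)) ⟩
    ∑∑ n (λ i j → + 2 * rowPrefix a i (suc j)) - ∑∑ n rowSquareStep - ∑∑ n colSquareStep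
      ≡⟨ cong₂ (λ u v → ∑∑ n (λ i j → + 2 * rowPrefix a i (suc j)) - u - v) rowSquares colSquares ⟩
    ∑∑ n (λ i j → + 2 * rowPrefix a i (suc j)) - + n - + n
      ≡⟨ cong (λ u → u - + n - + n) (trans (∑∑-distribˡ-* n (+ 2) _) (cong (+ 2 *_) ∑∑rowPrefix)) ⟩
    + 2 * (+ n + + (n C 2)) - + n - + n
      ≡⟨ cancel (+ n) (+ (n C 2)) ⟩
    + 2 * + (n C 2) ∎)
    where
    cancel : ∀ x y → + 2 * (x + y) - x - x ≡ + 2 * y
    cancel = solve-∀

antidiag : ℕ → ℕ → ℕ → ℤ
antidiag m i j = cond (suc (i ℕ.+ j) ℕ.≟ m) 1ℤ

record Extremal (m : ℕ) (a : ℕ → ℕ → ℤ) : Set where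
  field
    rowSum≡1         : ∀ i → i < m → rowPrefix a i m ≡ 1ℤ
    colPrefix-nonneg : ∀ i j → i < m → j < m → 0ℤ ≤ colPrefix a (suc i) j
    defect≡0         : ∀ i j → i < m → j < m → defect a i j ≡ 0ℤ

module _ {m} {a : ℕ → ℕ → ℤ} (E : Extremal (suc m) a) where
  open Extremal E

  lastColumn-colPrefix≡1 : ∀ i → i < suc m → colPrefix a (suc i) m ≡ 1ℤ
  lastColumn-colPrefix≡1 i i<1+m = sym (ℤₚ.i-j≡0⇒i≡j 1ℤ c (begin
    1ℤ - c                          ≡⟨ ℤₚ.*-identityˡ _ ⟨
    1ℤ * (1ℤ - c)                   ≡⟨ cong (_* (1ℤ - c)) (rowSum≡1 i i<1+m) ⟨
    rowPrefix a i (suc m) * (1ℤ - c) ≡⟨ defect≡0 i m i<1+m ℕₚ.≤-refl ⟩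
    0ℤ                              ∎))
    where
    c : ℤ
    c = colPrefix a (suc i) m

  corner≡1 : a 0 m ≡ 1ℤ
  corner≡1 = trans (sym (ℤₚ.+-identityˡ (a 0 m))) (lastColumn-colPrefix≡1 0 z<s)

  lastColumn≡0 : ∀ i → suc i < suc m → a (suc i) m ≡ 0ℤ
  lastColumn≡0 i 1+i<1+m = identityʳ-unique _ _ (trans
    (lastColumn-colPrefix≡1 (suc i) 1+i<1+m)
    (sym (lastColumn-colPrefix≡1 i (ℕₚ.m<n⇒m<1+n (s≤s⁻¹ 1+i<1+m)))))

  firstRow≡0 : ∀ j → j < m → a 0 j ≡ 0ℤ
  firstRow≡0 = ∑-nonneg-≡0 m (a 0) firstRow-nonneg firstRow-init≡0
    where
    firstRow-nonneg : ∀ j → j < m → 0ℤ ≤ a 0 j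
    firstRow-nonneg j j<m =
      subst (0ℤ ≤_) (ℤₚ.+-identityˡ (a 0 j)) (colPrefix-nonneg 0 j z<s (ℕₚ.m<n⇒m<1+n j<m))

    firstRow-init≡0 : rowPrefix a 0 m ≡ 0ℤ
    firstRow-init≡0 = identityˡ-unique _ _
      (trans (cong (λ x → rowPrefix a 0 m + x) (sym corner≡1)) (rowSum≡1 0 z<s))

  colPrefix-lowerRows : ∀ i j → j < m → colPrefix (λ k → a (suc k)) i j ≡ colPrefix a (suc i) j
  colPrefix-lowerRows i j j<m = begin
    c                      ≡⟨ ℤₚ.+-identityˡ c ⟨
    0ℤ + c                 ≡⟨ cong (_+ c) (firstRow≡0 j j<m) ⟨
    a 0 j + c              ≡⟨ ∑-shift i (λ k → a k j) ⟨
    colPrefix a (suc i) j  ∎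
    where
    c : ℤ
    c = colPrefix (λ k → a (suc k)) i j

  extremal-lowerRows : Extremal m (λ k → a (suc k))
  extremal-lowerRows = record
    { rowSum≡1 = λ i i<m → trans (sym (ℤₚ.+-identityʳ _)) (trans
        (cong (λ x → rowPrefix a (suc i) m + x) (sym (lastColumn≡0 i (s≤s i<m))))
        (rowSum≡1 (suc i) (s≤s i<m)))
    ; colPrefix-nonneg = λ i j i<m j<m → subst (0ℤ ≤_) (sym (colPrefix-lowerRows (suc i) j j<m))
        (colPrefix-nonneg (suc i) j (s≤s i<m) (ℕₚ.m<n⇒m<1+n j<m))
    ; defect≡0 = λ i j i<m j<m → trans
        (cong (λ c → rowPrefix a (suc i) (suc j) * (1ℤ - c)) (colPrefix-lowerRows (suc i) j j<m))
        (defect≡0 (suc i) j (s≤s i<m) (ℕₚ.m<n⇒m<1+n j<m))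
    }

antidiag-corner : ∀ m → antidiag (suc m) 0 m ≡ 1ℤ
antidiag-corner m = cond-yes (suc m ℕ.≟ suc m) refl

antidiag-firstRow : ∀ {m j} → j < m → antidiag (suc m) 0 j ≡ 0ℤ
antidiag-firstRow {m} {j} j<m = cond-no (suc j ℕ.≟ suc m) (λ e → ℕₚ.<⇒≢ j<m (ℕₚ.suc-injective e))

antidiag-lastColumn : ∀ m i → antidiag (suc m) (suc i) m ≡ 0ℤ
antidiag-lastColumn m i = cond-no (suc (suc i ℕ.+ m) ℕ.≟ suc m)
  (λ e → ℕₚ.<⇒≢ (s≤s (ℕₚ.m≤n+m m i)) (sym (ℕₚ.suc-injective e)))

antidiag-lowerRows : ∀ m i j → antidiag (suc m) (suc i) j ≡ antidiag m i j
antidiag-lowerRows m i j = cond-cong _ _ ℕₚ.suc-injective (cong suc) 1ℤ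

extremal⇒antidiag : ∀ m {a : ℕ → ℕ → ℤ} → Extremal m a → ∀ i j → i < m → j < m → a i j ≡ antidiag m i j
extremal⇒antidiag (suc m) E i j i<1+m j<1+m with i | ℕₚ.m≤n⇒m<n∨m≡n (s≤s⁻¹ j<1+m)
... | zero  | inj₂ refl = trans (corner≡1 E) (sym (antidiag-corner m))
... | zero  | inj₁ j<m  = trans (firstRow≡0 E j j<m) (sym (antidiag-firstRow j<m))
... | suc i | inj₂ refl = trans (lastColumn≡0 E i i<1+m) (sym (antidiag-lastColumn m i))
... | suc i | inj₁ j<m  = trans
  (extremal⇒antidiag m (extremal-lowerRows E) i j (s≤s⁻¹ i<1+m) j<m)
  (sym (antidiag-lowerRows m i j))

antidiag-sym : ∀ n i j → antidiag n i j ≡ antidiag n j i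
antidiag-sym n i j =
  cond-cong _ _ (trans (cong suc (ℕₚ.+-comm j i))) (trans (cong suc (ℕₚ.+-comm i j))) 1ℤ

∑-antidiag-column : ∀ n p j → j < n → ∑ p (λ k → antidiag n k j) ≡ cond (n ℕ.≤? p ℕ.+ j) 1ℤ
∑-antidiag-column n zero    j j<n = sym (cond-no (n ℕ.≤? j) (ℕₚ.<⇒≱ j<n))
∑-antidiag-column n (suc p) j j<n =
  trans (cong (_+ antidiag n p j) (∑-antidiag-column n p j j<n)) (step (n ℕ.≤? p ℕ.+ j))
  where
  step : (below : Dec (n ≤ℕ p ℕ.+ j)) → cond below 1ℤ + antidiag n p j ≡ cond (n ℕ.≤? suc p ℕ.+ j) 1ℤ
  step (yes n≤p+j) = trans
    (cong (λ x → 1ℤ + x) (cond-no (suc (p ℕ.+ j) ℕ.≟ n) (λ e → ℕₚ.<⇒≱ (ℕₚ.≤-reflexive e) n≤p+j)))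
    (sym (cond-yes (n ℕ.≤? suc p ℕ.+ j) (ℕₚ.m≤n⇒m≤1+n n≤p+j)))
  step (no n≰p+j) = trans (ℤₚ.+-identityˡ _) (cond-cong (suc (p ℕ.+ j) ℕ.≟ n) (n ℕ.≤? suc p ℕ.+ j)
    (λ e → ℕₚ.≤-reflexive (sym e)) (ℕₚ.≤-antisym (ℕₚ.≰⇒> n≰p+j)) 1ℤ)

antidiagonal≡antidiag : ∀ {n} (i j : Fin n) → antidiagonal i j ≡ antidiag n (toℕ i) (toℕ j)
antidiagonal≡antidiag {n} i j = trans unfold (cond-cong _ _ fwd bwd 1ℤ)
  where
  unfold : antidiagonal i j ≡ cond (toℕ j ℕ.≟ toℕ (opposite i)) 1ℤ
  unfold with toℕ j ℕ.≟ toℕ (opposite i)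
  ... | yes _ = refl
  ... | no _  = refl

  fwd : toℕ j ≡ toℕ (opposite i) → suc (toℕ i ℕ.+ toℕ j) ≡ n
  fwd e = trans (cong (suc (toℕ i) ℕ.+_) (trans e (opposite-prop i))) (ℕₚ.m+[n∸m]≡n (toℕ<n i))

  bwd : suc (toℕ i ℕ.+ toℕ j) ≡ n → toℕ j ≡ toℕ (opposite i)
  bwd e = trans (sym (ℕₚ.m+n∸m≡n (suc (toℕ i)) (toℕ j)))
                (trans (cong (ℕ._∸ suc (toℕ i)) e) (sym (opposite-prop i)))

module _ (n : ℕ) where

  extend-antidiagonal : ∀ x y → x < n → y < n → extend (antidiagonal {n}) x y ≡ antidiag n x y
  extend-antidiagonal = ∀Fin²⇒∀<² (λ i j → trans (sym (extend-toℕ _ i j)) (antidiagonal≡antidiag i j))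

  colPrefix-antidiagonal : ∀ p j → p ≤ℕ n → j < n →
    colPrefix (extend (antidiagonal {n})) p j ≡ cond (n ℕ.≤? p ℕ.+ j) 1ℤ
  colPrefix-antidiagonal p j p≤n j<n = trans
    (∑-cong p (λ k k<p → extend-antidiagonal k j (ℕₚ.<-≤-trans k<p p≤n) j<n))
    (∑-antidiag-column n p j j<n)

  rowPrefix-antidiagonal : ∀ i p → i < n → p ≤ℕ n →
    rowPrefix (extend (antidiagonal {n})) i p ≡ cond (n ℕ.≤? p ℕ.+ i) 1ℤ
  rowPrefix-antidiagonal i p i<n p≤n = trans
    (∑-cong p (λ l l<p →
      trans (extend-antidiagonal i l i<n (ℕₚ.<-≤-trans l<p p≤n)) (antidiag-sym n i l)))
    (∑-antidiag-column n p i i<n)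

  antidiagonal-rowSum≡1 : ∀ i → i < n → rowPrefix (extend (antidiagonal {n})) i n ≡ 1ℤ
  antidiagonal-rowSum≡1 i i<n =
    trans (rowPrefix-antidiagonal i n i<n ℕₚ.≤-refl) (cond-yes _ (ℕₚ.m≤m+n n i))

  antidiagonal-colSum≡1 : ∀ j → j < n → colPrefix (extend (antidiagonal {n})) n j ≡ 1ℤ
  antidiagonal-colSum≡1 j j<n =
    trans (colPrefix-antidiagonal n j ℕₚ.≤-refl j<n) (cond-yes _ (ℕₚ.m≤m+n n j))

  antidiagonal-defect≡0 : ∀ i j → i < n → j < n → defect (extend (antidiagonal {n})) i j ≡ 0ℤ
  antidiagonal-defect≡0 i j i<n j<n = begin
    rowPrefix a i (suc j) * (1ℤ - colPrefix a (suc i) j)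
      ≡⟨ cong₂ (λ r c → r * (1ℤ - c)) (rowPrefix-antidiagonal i (suc j) i<n j<n)
                                     (colPrefix-antidiagonal (suc i) j i<n j<n) ⟩
    cond (n ℕ.≤? suc j ℕ.+ i) 1ℤ * (1ℤ - cond (n ℕ.≤? suc i ℕ.+ j) 1ℤ)
      ≡⟨ cong (λ c → c * (1ℤ - cond (n ℕ.≤? suc i ℕ.+ j) 1ℤ))
              (cond-cong (n ℕ.≤? suc j ℕ.+ i) (n ℕ.≤? suc i ℕ.+ j) (flip {j} {i}) (flip {i} {j}) 1ℤ) ⟩
    cond (n ℕ.≤? suc i ℕ.+ j) 1ℤ * (1ℤ - cond (n ℕ.≤? suc i ℕ.+ j) 1ℤ)
      ≡⟨ cond-1*[1-cond-1]≡0 (n ℕ.≤? suc i ℕ.+ j) ⟩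
    0ℤ ∎
    where
    a : ℕ → ℕ → ℤ
    a = extend (antidiagonal {n})

    flip : ∀ {x y} → n ≤ℕ suc x ℕ.+ y → n ≤ℕ suc y ℕ.+ x
    flip {x} {y} = subst (n ≤ℕ_) (cong suc (ℕₚ.+-comm x y))

  antidiagonal-isSquareSignMatrix : IsSquareSignMatrix (antidiagonal {n})
  antidiagonal-isSquareSignMatrix = record
    { entries = λ i j → subst (λ x → (x ≡ 0ℤ) ⊎ ((x ≡ 1ℤ) ⊎ (x ≡ -1ℤ)))
        (sym (antidiagonal≡antidiag i j)) (cond-1-isSignEntry _)
    ; rowSum = λ i → trans (rowSum≡rowPrefix _ i) (antidiagonal-rowSum≡1 (toℕ i) (toℕ<n i))
    ; colSum = λ j → trans (colSum≡colPrefix _ j) (antidiagonal-colSum≡1 (toℕ j) (toℕ<n j))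
    ; colPartialBounds = λ i j → subst (λ x → (0ℤ ≤ x) × (x ≤ 1ℤ))
        (sym (trans (colPartial≡colPrefix _ i j)
                    (colPrefix-antidiagonal (suc (toℕ i)) (toℕ j) (toℕ<n i) (toℕ<n j))))
        (cond-1-bounds _)
    ; rowPartialNonneg = λ i j → subst (0ℤ ≤_)
        (sym (trans (rowPartial≡rowPrefix _ i j)
                    (rowPrefix-antidiagonal (toℕ i) (suc (toℕ j)) (toℕ<n i) (toℕ<n j))))
        (proj₁ (cond-1-bounds (n ℕ.≤? suc (toℕ j) ℕ.+ toℕ i)))
    }

  inv-antidiagonal : inv (antidiagonal {n}) ≡ + (n C 2)
  inv-antidiagonal = begin
    inv (antidiagonal {n})                ≡⟨ inv≡inversions (antidiagonal {n}) ⟩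
    inversions n a                        ≡⟨ ℤₚ.+-identityˡ _ ⟨
    0ℤ + inversions n a                   ≡⟨ cong (_+ inversions n a) ∑∑defect≡0 ⟨
    ∑∑ n (defect a) + inversions n a
      ≡⟨ ∑∑defect+inversions≡C2 n a antidiagonal-rowSum≡1 antidiagonal-colSum≡1 ⟩
    + (n C 2)                             ∎
    where
    a : ℕ → ℕ → ℤ
    a = extend (antidiagonal {n})

    ∑∑defect≡0 : ∑∑ n (defect a) ≡ 0ℤ
    ∑∑defect≡0 = trans (∑∑-cong n antidiagonal-defect≡0)
                       (trans (∑-cong n (λ _ _ → ∑-zeros n)) (∑-zeros n))

module _ {n} {A : Matrix n} (S : IsSquareSignMatrix A) where
  open IsSquareSignMatrix S

  signMatrix-rowSum≡1 : ∀ i → i < n → rowPrefix (extend A) i n ≡ 1ℤ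
  signMatrix-rowSum≡1 = ∀Fin⇒∀< (λ i → trans (sym (rowSum≡rowPrefix A i)) (rowSum i))

  signMatrix-colSum≡1 : ∀ j → j < n → colPrefix (extend A) n j ≡ 1ℤ
  signMatrix-colSum≡1 = ∀Fin⇒∀< (λ j → trans (sym (colSum≡colPrefix A j)) (colSum j))

  signMatrix-rowPrefix-nonneg : ∀ i j → i < n → j < n → 0ℤ ≤ rowPrefix (extend A) i (suc j)
  signMatrix-rowPrefix-nonneg =
    ∀Fin²⇒∀<² (λ i j → subst (0ℤ ≤_) (rowPartial≡rowPrefix A i j) (rowPartialNonneg i j))

  signMatrix-colPrefix-bounds : ∀ i j → i < n → j < n →
    (0ℤ ≤ colPrefix (extend A) (suc i) j) × (colPrefix (extend A) (suc i) j ≤ 1ℤ)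
  signMatrix-colPrefix-bounds = ∀Fin²⇒∀<² (λ i j →
    subst (λ x → (0ℤ ≤ x) × (x ≤ 1ℤ)) (colPartial≡colPrefix A i j) (colPartialBounds i j))

  signMatrix-defect-nonneg : ∀ i j → i < n → j < n → 0ℤ ≤ defect (extend A) i j
  signMatrix-defect-nonneg i j i<n j<n = *-nonneg
    (signMatrix-rowPrefix-nonneg i j i<n j<n)
    (ℤₚ.i≤j⇒0≤j-i (proj₂ (signMatrix-colPrefix-bounds i j i<n j<n)))

  signMatrix-∑∑defect+inv≡C2 : ∑∑ n (defect (extend A)) + inv A ≡ + (n C 2)
  signMatrix-∑∑defect+inv≡C2 = trans (cong (λ x → ∑∑ n (defect (extend A)) + x) (inv≡inversions A))
    (∑∑defect+inversions≡C2 n (extend A) signMatrix-rowSum≡1 signMatrix-colSum≡1)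

  inv-signMatrix-≤ : inv A ≤ + (n C 2)
  inv-signMatrix-≤ =
    nonneg+≡⇒≤ (∑∑-nonneg n _ signMatrix-defect-nonneg) signMatrix-∑∑defect+inv≡C2

  inv-signMatrix-≡⇒antidiagonal : inv A ≡ + (n C 2) → ∀ i j → A i j ≡ antidiagonal i j
  inv-signMatrix-≡⇒antidiagonal inv≡C2 i j = begin
    A i j                       ≡⟨ extend-toℕ A i j ⟩
    extend A (toℕ i) (toℕ j)    ≡⟨ extremal⇒antidiag n extremal _ _ (toℕ<n i) (toℕ<n j) ⟩
    antidiag n (toℕ i) (toℕ j)  ≡⟨ antidiagonal≡antidiag i j ⟨
    antidiagonal i j            ∎
    where
    ∑∑defect≡0 : ∑∑ n (defect (extend A)) ≡ 0ℤ
    ∑∑defect≡0 = identityˡ-unique _ _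
      (trans (cong (λ x → ∑∑ n (defect (extend A)) + x) (sym inv≡C2)) signMatrix-∑∑defect+inv≡C2)

    extremal : Extremal n (extend A)
    extremal = record
      { rowSum≡1         = signMatrix-rowSum≡1
      ; colPrefix-nonneg = λ i j i<n j<n → proj₁ (signMatrix-colPrefix-bounds i j i<n j<n)
      ; defect≡0         = ∑∑-nonneg-≡0 n _ signMatrix-defect-nonneg ∑∑defect≡0
      }

-- Neither n ≥ 1 nor the entries lying in {0, 1, -1} is needed.
lemma3p19 : (n : ℕ) → 1 ≤ℕ n →
    ((A : Matrix n) → IsSquareSignMatrix A → inv A ≤ + (n C 2))
    × IsSquareSignMatrix (antidiagonal {n})
    × inv (antidiagonal {n}) ≡ + (n C 2)
    × ((A : Matrix n) → IsSquareSignMatrix A → inv A ≡ + (n C 2) →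
        ∀ i j → A i j ≡ antidiagonal i j)
lemma3p19 n _ =
  (λ _ S → inv-signMatrix-≤ S) ,
  antidiagonal-isSquareSignMatrix n ,
  inv-antidiagonal n ,
  (λ _ S → inv-signMatrix-≡⇒antidiagonal S)
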